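{- Fix an integer $k\geq 1$. Let $\mathbb{F}=\mathbb{C}(x_0,\ldots,x_{2k},a)$ be the field of rational functions in independent indeterminates, and define $x_n\in\mathbb{F}$ for all $n\in\mathbb{Z}$ by iterating $x_{n+2k+1}x_n=x_{n+2k}x_{n+1}+a(x_{n+k}+x_{n+k+1})$ forwards and backwards from $x_0,\ldots,x_{2k}$. For $n\in\mathbb{Z}$ let $$\delta_n=\det\begin{pmatrix}x_n & x_{n+2k} & x_{n+4k}\\ x_{n+1}&x_{n+2k+1}&x_{n+4k+1}\\ x_{n+2}&x_{n+2k+2}&x_{n+4k+2}\end{pmatrix}.$$ Then $\delta_{n+k}=\delta_n$ for all $n\in\mathbb{Z}$ (i.e. $\delta_0$ is a $k$-invariant of the map $\varphi$).
   Context: All $x_n$ produced by the recurrence are nonzero elements of $\mathbb{F}$, so the iteration is well defined. The map $\varphi$ is $(x_0,\ldots,x_{2k})\mapsto(x_1,\ldots,x_{2k},(x_1x_{2k}+a(x_k+x_{k+1}))/x_0)$; its pullback $\varphi^*$ acts on $\mathbb{F}$ by $\varphi^*G(x_0,\ldots,x_{2k},a)=G(x_1,\ldots,x_{2k+1},a)$, so that $(\varphi^*)^m x_n=x_{n+m}$ and $\delta_n=(\varphi^*)^n\delta_0$. An element $G$ is a $p$-invariant if $(\varphi^*)^pG=G$. -}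

module Defs where

open import Level using (Level)
open import Algebra.Bundles using (CommutativeRing)
open import Data.Product using (Σ; _×_)
open import Relation.Nullary using (¬_)
open import Data.Nat using (ℕ)
open import Data.Integer using (ℤ; +_) renaming (_+_ to _ℤ+_)

module _ {c ℓ : Level} (R : CommutativeRing c ℓ) where
  open CommutativeRing R

  IsField : Set (c Level.⊔ ℓ)
  IsField = (¬ (1# ≈ 0#)) × (∀ x → ¬ (x ≈ 0#) → Σ Carrier (λ y → x * y ≈ 1#))

  det3 : (m11 m12 m13 m21 m22 m23 m31 m32 m33 : Carrier) → Carrier
  det3 m11 m12 m13 m21 m22 m23 m31 m32 m33 =
    (m11 * (m22 * m33) + (m12 * (m23 * m31) + m13 * (m21 * m32)))
    - (m13 * (m22 * m31) + (m12 * (m21 * m33) + m11 * (m23 * m32)))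

  SatisfiesRecurrence : (k : ℕ) (a : Carrier) (x : ℤ → Carrier) → Set ℓ
  SatisfiesRecurrence k a x = ∀ (n : ℤ) →
    x (n ℤ+ + (2 Data.Nat.* k Data.Nat.+ 1)) * x n
      ≈ x (n ℤ+ + (2 Data.Nat.* k)) * x (n ℤ+ + 1)
        + a * (x (n ℤ+ + k) + x (n ℤ+ + (k Data.Nat.+ 1)))

  δ : (k : ℕ) (x : ℤ → Carrier) (n : ℤ) → Carrier
  δ k x n =
    det3 (x n)           (x (n ℤ+ + (2 Data.Nat.* k)))               (x (n ℤ+ + (4 Data.Nat.* k)))
         (x (n ℤ+ + 1))  (x (n ℤ+ + (2 Data.Nat.* k Data.Nat.+ 1)))  (x (n ℤ+ + (4 Data.Nat.* k Data.Nat.+ 1)))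
         (x (n ℤ+ + 2))  (x (n ℤ+ + (2 Data.Nat.* k Data.Nat.+ 2)))  (x (n ℤ+ + (4 Data.Nat.* k Data.Nat.+ 2)))

-- Write Pₙ = x_{n+k+1} x_{n+2k+1} and Jₙ = (x_{n+k+1} + x_{n+k+2})(x_{n+2k} + x_{n+2k+1})
-- + (x_{n+k} + x_{n+k+1})(x_{n+2k+1} + x_{n+2k+2}). Eliminating with the recurrence at n, n + 1,
-- n + k, n + k + 1, n + 2k and n + 2k + 1 gives δₙ Pₙ = a³ Jₙ, and the recurrence at n + k and
-- n + k + 1 alone gives Jₙ / Pₙ = J_{n+k} / P_{n+k}. So δₙ = a³ Jₙ / Pₙ is k-periodic.

module Submission where

open import Defs
open import Level using (Level)
open import Algebra.Bundles using (CommutativeRing)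
open import Relation.Nullary using (¬_)
open import Data.Nat using (ℕ; _≤_)

open import Data.Product using (_×_; _,_; proj₂)
open import Data.List using (_∷_; [])
import Data.Nat as Nat
import Data.Integer.Properties as ℤ
open import Relation.Binary.PropositionalEquality as ≡ using (_≡_)

module Columns {c ℓ : Level} (R : CommutativeRing c ℓ) where
  open CommutativeRing R
  open import Algebra.Properties.Group +-group using (∙-cancelʳ; //-rightDividesˡ)
  open import Algebra.Solver.Ring.NaturalCoefficients.Default commutativeSemiring
  open import Relation.Binary.Reasoning.Setoid setoid

  -- w₁ u₀ = w₀ u₁ + a (v₀ + v₁) is the recurrence with (u, v, w) = (x_m, x_{m+k}, x_{m+2k}).
  RecurrenceStep : (a u₀ u₁ v₀ v₁ w₀ w₁ : Carrier) → Set ℓ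
  RecurrenceStep a u₀ u₁ v₀ v₁ w₀ w₁ = w₁ * u₀ ≈ w₀ * u₁ + a * (v₀ + v₁)

  RecurrenceStep-cong : ∀ {a u₀ u₁ v₀ v₁ w₀ w₁ u₁′ v₀′ v₁′ w₀′ w₁′} →
    u₁ ≈ u₁′ → v₀ ≈ v₀′ → v₁ ≈ v₁′ → w₀ ≈ w₀′ → w₁ ≈ w₁′ →
    RecurrenceStep a u₀ u₁ v₀ v₁ w₀ w₁ → RecurrenceStep a u₀ u₁′ v₀′ v₁′ w₀′ w₁′
  RecurrenceStep-cong u₁≈ v₀≈ v₁≈ w₀≈ w₁≈ step =
    trans (*-congʳ (sym w₁≈)) (trans step (+-cong (*-cong w₀≈ u₁≈) (*-congˡ (+-cong v₀≈ v₁≈))))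

  Column : Set c
  Column = Carrier × Carrier × Carrier

  det : Column → Column → Column → Carrier
  det (p₀ , p₁ , p₂) (q₀ , q₁ , q₂) (r₀ , r₁ , r₂) = det3 R p₀ q₀ r₀ p₁ q₁ r₁ p₂ q₂ r₂

  middle : Column → Carrier
  middle (_ , p₁ , _) = p₁

  Linked : Carrier → Column → Column → Column → Set ℓ
  Linked a (p₀ , p₁ , p₂) (q₀ , q₁ , q₂) (r₀ , r₁ , r₂) =
    RecurrenceStep a p₀ p₁ q₀ q₁ r₀ r₁ × RecurrenceStep a p₁ p₂ q₁ q₂ r₁ r₂

  det-cong : ∀ {p p′ q q′ r r′} → p ≡ p′ → q ≡ q′ → r ≡ r′ → det p q r ≡ det p′ q′ r′
  det-cong ≡.refl ≡.refl ≡.refl = ≡.refl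

  pairing : Column → Column → Carrier
  pairing (q₀ , q₁ , q₂) (r₀ , r₁ , r₂) = (q₁ + q₂) * (r₀ + r₁) + (q₀ + q₁) * (r₁ + r₂)

  x+u≈y+v∧u≈v⇒x≈y : ∀ {x y u v} → x + u ≈ y + v → u ≈ v → x ≈ y
  x+u≈y+v∧u≈v⇒x≈y {x} {y} {u} {v} eq u≈v = ∙-cancelʳ v x y (trans (+-congˡ (sym u≈v)) eq)

  x*z≈y*z+w⇒[x-y]*z≈w : ∀ {x y z w} → x * z ≈ y * z + w → (x - y) * z ≈ w
  x*z≈y*z+w⇒[x-y]*z≈w {x} {y} {z} {w} eq = ∙-cancelʳ (y * z) ((x - y) * z) w (begin
    (x - y) * z + y * z  ≈⟨ distribʳ z (x - y) y ⟨
    (x - y + y) * z      ≈⟨ *-congʳ (//-rightDividesˡ y x) ⟩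
    x * z                ≈⟨ eq ⟩
    y * z + w            ≈⟨ +-comm (y * z) w ⟩
    w + y * z            ∎)

  -- The semiring solver cannot use hypotheses, so the recurrence enters through a polynomial
  -- identity  A·W + S₁ = B·W + a³·J + S₂  in which S₁ and S₂ become the same expression once
  -- some of their factors are rewritten by the recurrence; here det = A − B and W = r₁ q₁.
  det-linked : ∀ {a p q r s t} → Linked a p q r → Linked a q r s → Linked a r s t →
    det p r t * (middle r * middle q) ≈ a * (a * a) * pairing q r
  det-linked {a} {p₀ , p₁ , p₂} {q₀ , q₁ , q₂} {r₀ , r₁ , r₂} {s₀ , s₁ , s₂} {t₀ , t₁ , t₂}
             (pqr₁ , pqr₂) (qrs₁ , qrs₂) (rst₁ , rst₂) =
    x*z≈y*z+w⇒[x-y]*z≈w (x+u≈y+v∧u≈v⇒x≈y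
      (solve 16 (λ p₀ p₁ p₂ q₀ q₁ q₂ r₀ r₁ r₂ s₀ s₁ s₂ t₀ t₁ t₂ a →
        (p₀ :* (r₁ :* t₂) :+ (r₀ :* (t₁ :* p₂) :+ t₀ :* (p₁ :* r₂))) :* (r₁ :* q₁)
        :+ (q₁ :* (p₀ :* r₁) :* (t₁ :* r₂ :+ a :* (s₁ :+ s₂))
        :+ (q₁ :* (p₁ :* r₀) :* (t₂ :* r₁)
        :+ (q₁ :* (a :* (s₁ :+ s₂)) :* (r₀ :* p₁ :+ a :* (q₀ :+ q₁))
        :+ (q₁ :* (r₀ :* t₁) :* (r₂ :* p₁)
        :+ (q₁ :* (r₁ :* t₀) :* (r₁ :* p₂ :+ a :* (q₁ :+ q₂))
        :+ (q₁ :* (a :* (q₁ :+ q₂)) :* (t₁ :* r₀)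
        :+ (a :* a :* (q₁ :+ q₂) :* (s₀ :* q₁ :+ a :* (r₀ :+ r₁))
        :+ a :* a :* (q₀ :+ q₁) :* (s₁ :* q₂ :+ a :* (r₁ :+ r₂)))))))))
        :=
        ((t₀ :* (r₁ :* p₂) :+ (r₀ :* (p₁ :* t₂) :+ p₀ :* (t₁ :* r₂))) :* (r₁ :* q₁)
          :+ a :* (a :* a) :* ((q₁ :+ q₂) :* (r₀ :+ r₁) :+ (q₀ :+ q₁) :* (r₁ :+ r₂)))
        :+ (q₁ :* (p₀ :* r₁) :* (t₂ :* r₁)
        :+ (q₁ :* (p₁ :* r₀) :* (t₁ :* r₂ :+ a :* (s₁ :+ s₂))
        :+ (q₁ :* (a :* (s₁ :+ s₂)) :* (r₁ :* p₀)
        :+ (q₁ :* (r₀ :* t₁) :* (r₁ :* p₂ :+ a :* (q₁ :+ q₂))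
        :+ (q₁ :* (r₁ :* t₀) :* (r₂ :* p₁)
        :+ (q₁ :* (a :* (q₁ :+ q₂)) :* (t₀ :* r₁ :+ a :* (s₀ :+ s₁))
        :+ (a :* a :* (q₁ :+ q₂) :* (s₁ :* q₀)
        :+ a :* a :* (q₀ :+ q₁) :* (s₂ :* q₁)))))))))
        refl p₀ p₁ p₂ q₀ q₁ q₂ r₀ r₁ r₂ s₀ s₁ s₂ t₀ t₁ t₂ a)
      (trans (+-cong refl (+-cong (*-congˡ rst₂) (+-cong refl (+-cong (*-congˡ pqr₂)
               (+-cong refl (+-cong (*-congˡ rst₁) (+-cong refl refl)))))))
             (sym (+-cong (*-congˡ rst₂) (+-cong refl (+-cong (*-congˡ pqr₁) (+-cong refl
               (+-cong (*-congˡ pqr₂) (+-cong refl (+-cong (*-congˡ qrs₁) (*-congˡ qrs₂)))))))))))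

  pairing-shift : ∀ {a q r s} → Linked a q r s →
    pairing q r * (middle s * middle r) ≈ pairing r s * (middle r * middle q)
  pairing-shift {a} {q₀ , q₁ , q₂} {r₀ , r₁ , r₂} {s₀ , s₁ , s₂} (qrs₁ , qrs₂) =
    x+u≈y+v∧u≈v⇒x≈y
      (solve 10 (λ q₀ q₁ q₂ r₀ r₁ r₂ s₀ s₁ s₂ a →
        ((q₁ :+ q₂) :* (r₀ :+ r₁) :+ (q₀ :+ q₁) :* (r₁ :+ r₂)) :* (s₁ :* r₁)
        :+ (r₁ :* (r₁ :+ r₂) :* (s₀ :* q₁ :+ a :* (r₀ :+ r₁)) :+ r₁ :* (r₀ :+ r₁) :* (s₂ :* q₁))
        :=
        ((r₁ :+ r₂) :* (s₀ :+ s₁) :+ (r₀ :+ r₁) :* (s₁ :+ s₂)) :* (r₁ :* q₁)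
        :+ (r₁ :* (r₁ :+ r₂) :* (s₁ :* q₀) :+ r₁ :* (r₀ :+ r₁) :* (s₁ :* q₂ :+ a :* (r₁ :+ r₂))))
        refl q₀ q₁ q₂ r₀ r₁ r₂ s₀ s₁ s₂ a)
      (+-cong (*-congˡ (sym qrs₁)) (*-congˡ qrs₂))

  module _ (isField : IsField R) where

    *-nonZero : ∀ {x y} → ¬ x ≈ 0# → ¬ y ≈ 0# → ¬ x * y ≈ 0#
    *-nonZero {x} {y} x≉0 y≉0 xy≈0 with proj₂ isField x x≉0
    ... | x⁻¹ , xx⁻¹≈1 = y≉0 (begin
      y              ≈⟨ *-identityˡ y ⟨
      1# * y         ≈⟨ *-congʳ (trans (sym xx⁻¹≈1) (*-comm x x⁻¹)) ⟩
      x⁻¹ * x * y    ≈⟨ *-assoc x⁻¹ x y ⟩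
      x⁻¹ * (x * y)  ≈⟨ *-congˡ xy≈0 ⟩
      x⁻¹ * 0#       ≈⟨ zeroʳ x⁻¹ ⟩
      0#             ∎)

    *-cancelʳ-nonZero : ∀ {x y z} → ¬ z ≈ 0# → x * z ≈ y * z → x ≈ y
    *-cancelʳ-nonZero {x} {y} {z} z≉0 xz≈yz with proj₂ isField z z≉0
    ... | z⁻¹ , zz⁻¹≈1 = begin
      x              ≈⟨ *-identityʳ x ⟨
      x * 1#         ≈⟨ *-congˡ zz⁻¹≈1 ⟨
      x * (z * z⁻¹)  ≈⟨ *-assoc x z z⁻¹ ⟨
      x * z * z⁻¹    ≈⟨ *-congʳ xz≈yz ⟩
      y * z * z⁻¹    ≈⟨ *-assoc y z z⁻¹ ⟩
      y * (z * z⁻¹)  ≈⟨ *-congˡ zz⁻¹≈1 ⟩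
      y * 1#         ≈⟨ *-identityʳ y ⟩
      y              ∎

    det-shift : ∀ {a p q r s t u} →
      Linked a p q r → Linked a q r s → Linked a r s t → Linked a s t u →
      ¬ middle q ≈ 0# → ¬ middle r ≈ 0# → ¬ middle s ≈ 0# →
      det q s u ≈ det p r t
    det-shift {a} {p} {q} {r} {s} {t} {u} pqr qrs rst stu q≉0 r≉0 s≉0 =
      *-cancelʳ-nonZero (*-nonZero (*-nonZero s≉0 r≉0) (*-nonZero r≉0 q≉0)) (begin
        det q s u * (V * W)         ≈⟨ *-assoc (det q s u) V W ⟨
        det q s u * V * W           ≈⟨ *-congʳ (det-linked qrs rst stu) ⟩
        a³ * pairing r s * W        ≈⟨ *-assoc a³ (pairing r s) W ⟩
        a³ * (pairing r s * W)      ≈⟨ *-congˡ (pairing-shift qrs) ⟨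
        a³ * (pairing q r * V)      ≈⟨ *-assoc a³ (pairing q r) V ⟨
        a³ * pairing q r * V        ≈⟨ *-congʳ (det-linked pqr qrs rst) ⟨
        det p r t * W * V           ≈⟨ *-assoc (det p r t) W V ⟩
        det p r t * (W * V)         ≈⟨ *-congˡ (*-comm W V) ⟩
        det p r t * (V * W)         ∎)
      where
      a³ W V : Carrier
      a³ = a * (a * a)
      W = middle r * middle q
      V = middle s * middle r

open import Data.Integer using (ℤ; +_; _+_)

module Sequence {c ℓ : Level} (R : CommutativeRing c ℓ) (k : ℕ)
  (a : CommutativeRing.Carrier R) (x : ℤ → CommutativeRing.Carrier R)
  (recurrence : SatisfiesRecurrence R k a x) where
  open CommutativeRing R using (Carrier; _≈_; reflexive)
  open Columns R
  open Nat using (suc; _*_)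
  open import Data.Nat.Properties using (+-assoc; +-identityʳ)
  open import Data.Nat.Tactic.RingSolver using (solve)

  entry : ℤ → ℕ → ℕ → Carrier
  entry m j i = x (m + + (j * k Nat.+ i))

  column : ℤ → ℕ → Column
  column m j = entry m j 0 , entry m j 1 , entry m j 2

  δ≡det-columns : ∀ m → δ R k x m ≡ det (column m 0) (column m 2) (column m 4)
  δ≡det-columns m =
    det-cong (≡.cong (λ x₀ → x₀ , entry m 0 1 , entry m 0 2) (≡.cong x (≡.sym (ℤ.+-identityʳ m))))
             (lead-entry 2) (lead-entry 4)
    where
    lead-entry : ∀ j → (x (m + + (j * k)) , entry m j 1 , entry m j 2) ≡ column m j
    lead-entry j = ≡.cong (λ e → x (m + + e) , entry m j 1 , entry m j 2) (≡.sym (+-identityʳ (j * k)))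

  entry-+k : ∀ m j i → entry (m + + k) j i ≡ entry m (suc j) i
  entry-+k m j i = ≡.cong x (≡.trans (ℤ.+-assoc m (+ k) (+ (j * k Nat.+ i)))
                                     (≡.cong (λ e → m + + e) (≡.sym (+-assoc k (j * k) i))))

  δ-+k≡det-columns : ∀ m → δ R k x (m + + k) ≡ det (column m 1) (column m 3) (column m 5)
  δ-+k≡det-columns m = ≡.trans (δ≡det-columns (m + + k)) (det-cong (column-+k 0) (column-+k 2) (column-+k 4))
    where
    column-+k : ∀ j → column (m + + k) j ≡ column m (suc j)
    column-+k j = ≡.cong₂ _,_ (entry-+k m j 0) (≡.cong₂ _,_ (entry-+k m j 1) (entry-+k m j 2))

  recurrence-entries : ∀ m j i →
    RecurrenceStep a (entry m j i) (entry m j (suc i))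
                     (entry m (suc j) i) (entry m (suc j) (suc i))
                     (entry m (suc (suc j)) i) (entry m (suc (suc j)) (suc i))
  recurrence-entries m j i =
    RecurrenceStep-cong (shift 1 j (suc i) (solve (j ∷ k ∷ i ∷ [])))
                        (shift k (suc j) i (solve (j ∷ k ∷ i ∷ [])))
                        (shift (k Nat.+ 1) (suc j) (suc i) (solve (j ∷ k ∷ i ∷ [])))
                        (shift (2 * k) (suc (suc j)) i (solve (j ∷ k ∷ i ∷ [])))
                        (shift (2 * k Nat.+ 1) (suc (suc j)) (suc i) (solve (j ∷ k ∷ i ∷ [])))
                        (recurrence (m + + (j * k Nat.+ i)))
    where
    shift : ∀ f j′ i′ → j * k Nat.+ i Nat.+ f ≡ j′ * k Nat.+ i′ →
            x ((m + + (j * k Nat.+ i)) + + f) ≈ entry m j′ i′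
    shift f j′ i′ eq = reflexive (≡.cong x (≡.trans (ℤ.+-assoc m (+ (j * k Nat.+ i)) (+ f))
                                                    (≡.cong (λ e → m + + e) eq)))

  linked : ∀ m j → Linked a (column m j) (column m (suc j)) (column m (suc (suc j)))
  linked m j = recurrence-entries m j 0 , recurrence-entries m j 1

proposition2p2 : {c ℓ : Level} (F : CommutativeRing c ℓ) → IsField F →
    (k : ℕ) → 1 ≤ k →
    (a : CommutativeRing.Carrier F) (x : ℤ → CommutativeRing.Carrier F) →
    (∀ (n : ℤ) → ¬ (CommutativeRing._≈_ F (x n) (CommutativeRing.0# F))) →
    SatisfiesRecurrence F k a x →
    ∀ (n : ℤ) → CommutativeRing._≈_ F (δ F k x (n + + k)) (δ F k x n)
proposition2p2 F isField k _ a x x≉0 recurrence n = begin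
  δ F k x (n + + k)                           ≡⟨ δ-+k≡det-columns n ⟩
  det (column n 1) (column n 3) (column n 5)  ≈⟨ det-shift isField (linked n 0) (linked n 1) (linked n 2) (linked n 3)
                                                                 (x≉0 _) (x≉0 _) (x≉0 _) ⟩
  det (column n 0) (column n 2) (column n 4)  ≡⟨ δ≡det-columns n ⟨
  δ F k x n                                   ∎
  where
  open CommutativeRing F using (setoid)
  open import Relation.Binary.Reasoning.Setoid setoid
  open Columns F
  open Sequence F k a x recurrence
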